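{- Let $G$ be a connected self-contained graph. If $\mathrm{Fnd}(G)=\emptyset$ (the null graph), then $G$ contains a ray.
   Context: All graphs are simple; $\emptyset$ denotes the null graph (no vertices). A ray is a one-way infinite path. A self-contained graph is an infinite graph which is isomorphic to one of its proper induced subgraphs. For an induced subgraph $H$ of $G$, $G \setminus H$ denotes $G[V(G)\setminus V(H)]$. For a self-contained graph $G$, a removable subgraph of $G$ is a proper induced subgraph $H$ of $G$ with $V(H)\neq\emptyset$ such that $G\setminus H \cong G$; $\mathrm{Rem}(G)$ is the set of removable subgraphs. The foundation $\mathrm{Fnd}(G)=\bigcap_{H\in\mathrm{Rem}(G)} G\setminus H$ is the induced subgraph of $G$ on the vertices lying in no removable subgraph of $G$. -}

module Defs where

open import Data.Nat using (ℕ; suc)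
open import Data.Bool using (Bool; true; false; not)
open import Data.Product using (Σ; ∃; _×_; _,_; proj₁)
open import Data.Empty using (⊥)
open import Relation.Nullary using (¬_)
open import Relation.Binary.PropositionalEquality using (_≡_)
open import Function.Bundles using (_↔_; _⇔_; Inverse; Equivalence)
open import Function.Definitions using (Injective)

record Graph : Set₁ where
  field
    V     : Set
    E     : V → V → Set
    sym   : ∀ {x y} → E x y → E y x
    irrefl : ∀ {x} → ¬ E x x
open Graph public

-- Vertex subsets (under excluded middle every subset is decidable).
VSubset : Graph → Set
VSubset G = V G → Bool

induced : (G : Graph) → VSubset G → Graph
induced G S = record
  { V = Σ (V G) (λ v → S v ≡ true)
  ; E = λ a b → E G (proj₁ a) (proj₁ b)
  ; sym = sym G
  ; irrefl = irrefl G
  }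

-- complement of a vertex subset: G \ H is induced G (complement S)
complement : (G : Graph) → VSubset G → VSubset G
complement G S v = not (S v)

_≅_ : Graph → Graph → Set
G ≅ H = Σ (V G ↔ V H) λ f →
  ∀ x y → E G x y ⇔ E H (Inverse.to f x) (Inverse.to f y)

Proper : (G : Graph) → VSubset G → Set
Proper G S = ∃ λ v → S v ≡ false

NonEmpty : (G : Graph) → VSubset G → Set
NonEmpty G S = ∃ λ v → S v ≡ true

-- Self-contained: isomorphic to a proper induced subgraph
-- (this forces G to be (Dedekind-)infinite).
SelfContained : Graph → Set
SelfContained G = Σ (VSubset G) λ S → Proper G S × (G ≅ induced G S)

Removable : (G : Graph) → VSubset G → Set
Removable G S = Proper G S × NonEmpty G S × (induced G (complement G S) ≅ G)

InFnd : (G : Graph) → V G → Set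
InFnd G v = ∀ (S : VSubset G) → Removable G S → S v ≡ false

Fnd : Graph → Graph
Fnd G = record
  { V = Σ (V G) (InFnd G)
  ; E = λ a b → E G (proj₁ a) (proj₁ b)
  ; sym = sym G
  ; irrefl = irrefl G
  }

IsNull : Graph → Set
IsNull G = ¬ V G

data Walk (G : Graph) : V G → V G → Set where
  here : ∀ {v} → Walk G v v
  step : ∀ {u w v} → E G u w → Walk G w v → Walk G u v

Connected : Graph → Set
Connected G = ∀ (u v : V G) → Walk G u v

-- A ray in G (as a subgraph, not necessarily induced).
record Ray (G : Graph) : Set where
  field
    r      : ℕ → V G
    inj    : Injective _≡_ _≡_ r
    adj    : ∀ n → E G (r n) (r (suc n))

-- Empty foundation means every vertex u lies in a removable subgraph
-- H, and an isomorphism G ≅ G \ H is a self-embedding of G (injective and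
-- edge-preserving) whose image misses u.  Composing such embeddings, for any
-- self-embedding Θ and any finite list L of vertices there is Φ with Θ ∘ Φ
-- missing every vertex of L.  Fix a vertex a.  We build an infinite walk in
-- phases: in phase n we have an embedding Ψₙ (Ψ₀ = id), pick Φₙ so that
-- Ψₙ ∘ Φₙ misses everything visited so far, and traverse the Ψₙ-image of a
-- walk from a to Φₙ(a) (connectedness), which ends at Ψₙ₊₁(a) where
-- Ψₙ₊₁ = Ψₙ ∘ Φₙ.  All later phases stay inside the decreasing images of
-- the Ψ's, so each vertex, once two phase boundaries have passed, is never
-- visited again.  Finally, a walk in which every vertex is eventually left
-- for good yields a ray, by repeatedly jumping to the last visit of the
-- current vertex.

module Submission where

open import Defs
open import Level using (0ℓ)
open import Axiom.ExcludedMiddle using (ExcludedMiddle)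
open import Axiom.UniquenessOfIdentityProofs using (module Decidable⇒UIP)
open import Data.Nat using (ℕ; zero; suc; _+_; _∸_; _≤_; _<_; z≤n; s≤s; _≤?_; _≟_)
open import Data.Nat.Properties
  using (≰⇒>; ≤∧≢⇒<; <-cmp; m≤n⇒m<n∨m≡n; <-trans; m+[n∸m]≡n)
open import Data.Bool using (true; false; not)
import Data.Bool as Bool
open import Data.Bool.Properties using (¬-not; not-injective)
open import Data.Product using (Σ; ∃; _×_; _,_; proj₁; proj₂)
open import Data.Sum using (inj₁; inj₂)
open import Data.Empty using (⊥-elim)
open import Relation.Nullary using (¬_; yes; no)
open import Relation.Binary.PropositionalEquality
  using (_≡_; _≢_; refl; cong; subst; subst₂) renaming (sym to ≡-sym; trans to ≡-trans)
open import Relation.Binary.Definitions using (tri<; tri≈; tri>)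
open import Data.List using (List; []; _∷_)
open import Data.List.Relation.Unary.All as All using (All; []; _∷_)
open import Function.Bundles using (Inverse; Equivalence)

-- A walk w in which every vertex is eventually left for good contains a ray:
-- jump from each position to the last visit of its vertex and step on.
module RayFromTransientWalk (G : Graph) (em : ExcludedMiddle 0ℓ)
  (w : ℕ → V G) (adjacent : ∀ i → E G (w i) (w (suc i)))
  (transient : ∀ i → ∃ λ N → ∀ j → N ≤ j → w j ≢ w i) where

  lastVisit : (u : V G) (N : ℕ) → (∀ j → N ≤ j → w j ≢ u) → (i : ℕ) → w i ≡ u →
              ∃ λ j → w j ≡ u × i ≤ j × (∀ k → j < k → w k ≢ u)
  lastVisit u zero never i wi = ⊥-elim (never i z≤n wi)
  lastVisit u (suc M) never i wi with em {w M ≡ u}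
  ... | yes wM = M , wM , i≤M , never
    where
      i≤M : i ≤ M
      i≤M with i ≤? M
      ... | yes i≤M = i≤M
      ... | no i≰M = ⊥-elim (never i (≰⇒> i≰M) wi)
  ... | no ¬wM = lastVisit u M never′ i wi
    where
      never′ : ∀ j → M ≤ j → w j ≢ u
      never′ j M≤j with M ≟ j
      ... | yes refl = ¬wM
      ... | no M≢j = never j (≤∧≢⇒< M≤j M≢j)

  lastOf : ℕ → ℕ
  lastOf i = proj₁ (lastVisit (w i) (proj₁ (transient i)) (proj₂ (transient i)) i refl)

  lastOf-same : ∀ i → w (lastOf i) ≡ w i
  lastOf-same i = proj₁ (proj₂ (lastVisit (w i) _ (proj₂ (transient i)) i refl))

  lastOf-≥ : ∀ i → i ≤ lastOf i
  lastOf-≥ i = proj₁ (proj₂ (proj₂ (lastVisit (w i) _ (proj₂ (transient i)) i refl)))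

  lastOf-isLast : ∀ i k → lastOf i < k → w k ≢ w (lastOf i)
  lastOf-isLast i k lt eq =
    proj₂ (proj₂ (proj₂ (lastVisit (w i) _ (proj₂ (transient i)) i refl))) k lt
      (≡-trans eq (lastOf-same i))

  pos : ℕ → ℕ
  pos zero = lastOf 0
  pos (suc k) = lastOf (suc (pos k))

  pos-isLast : ∀ k j → pos k < j → w j ≢ w (pos k)
  pos-isLast zero = lastOf-isLast 0
  pos-isLast (suc k) = lastOf-isLast (suc (pos k))

  pos-< : ∀ k → pos k < pos (suc k)
  pos-< k = lastOf-≥ (suc (pos k))

  pos-mono : ∀ {k m} → k < m → pos k < pos m
  pos-mono {k} {suc m} (s≤s k≤m) with m≤n⇒m<n∨m≡n k≤m
  ... | inj₁ k<m = <-trans (pos-mono k<m) (pos-< m)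
  ... | inj₂ refl = pos-< k

  pos-injective : ∀ {k m} → w (pos k) ≡ w (pos m) → k ≡ m
  pos-injective {k} {m} eq with <-cmp k m
  ... | tri< k<m _ _ = ⊥-elim (pos-isLast k (pos m) (pos-mono k<m) (≡-sym eq))
  ... | tri≈ _ k≡m _ = k≡m
  ... | tri> _ _ m<k = ⊥-elim (pos-isLast m (pos k) (pos-mono m<k) eq)

  ray : Ray G
  ray = record
    { r = λ k → w (pos k)
    ; inj = pos-injective
    ; adj = λ k → subst (E G (w (pos k))) (≡-sym (lastOf-same (suc (pos k))))
                        (adjacent (pos k))
    }

record SelfEmbedding (G : Graph) : Set where
  constructor embedding
  field
    map       : V G → V G
    injective : ∀ {x y} → map x ≡ map y → x ≡ y
    preserves : ∀ {x y} → E G x y → E G (map x) (map y)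
open SelfEmbedding

module _ {G : Graph} where

  idEmb : SelfEmbedding G
  idEmb = embedding (λ x → x) (λ p → p) (λ e → e)

  _∘ₑ_ : SelfEmbedding G → SelfEmbedding G → SelfEmbedding G
  Θ ∘ₑ Φ = embedding (λ x → map Θ (map Φ x)) (λ p → injective Φ (injective Θ p))
                     (λ e → preserves Θ (preserves Φ e))

  Image : SelfEmbedding G → V G → Set
  Image Θ u = ∃ λ x → map Θ x ≡ u

  image-∘ : ∀ Θ Φ {u} → Image (Θ ∘ₑ Φ) u → Image Θ u
  image-∘ Θ Φ (x , p) = map Φ x , p

embeddingOutside : (G : Graph) (S : VSubset G) → induced G (complement G S) ≅ G →
  Σ (SelfEmbedding G) λ ψ → ∀ x → S (map ψ x) ≡ false
embeddingOutside G S (iso , edges) =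
  embedding ψ ψ-injective ψ-preserves , λ x → not-injective (proj₂ (from x))
  where
    open Inverse iso
    module UIP = Decidable⇒UIP Bool._≟_

    ψ : V G → V G
    ψ x = proj₁ (from x)

    -- Membership proofs in a subset are unique, so vertices of G \ H are
    -- determined by their underlying vertex of G.
    same-vertex : ∀ {v v′} (p : not (S v) ≡ true) (p′ : not (S v′) ≡ true) → v ≡ v′ →
                  _≡_ {A = V (induced G (complement G S))} (v , p) (v′ , p′)
    same-vertex p p′ refl = cong (_ ,_) (UIP.≡-irrelevant p p′)

    ψ-injective : ∀ {x y} → ψ x ≡ ψ y → x ≡ y
    ψ-injective {x} {y} eq = ≡-trans (≡-sym (strictlyInverseˡ x))
      (≡-trans (cong to (same-vertex (proj₂ (from x)) (proj₂ (from y)) eq))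
               (strictlyInverseˡ y))

    ψ-preserves : ∀ {x y} → E G x y → E G (ψ x) (ψ y)
    ψ-preserves {x} {y} e = Equivalence.from (edges (from x) (from y))
      (subst₂ (E G) (≡-sym (strictlyInverseˡ x)) (≡-sym (strictlyInverseˡ y)) e)

EveryVertexAvoidable : Graph → Set
EveryVertexAvoidable G = (u : V G) → Σ (SelfEmbedding G) λ ψ → ¬ Image ψ u

-- This holds when the foundation is empty: a vertex u in no removable
-- subgraph would lie in Fnd(G); if u ∈ H removable, use embeddingOutside.
avoidVertex : (G : Graph) → ExcludedMiddle 0ℓ → IsNull (Fnd G) → EveryVertexAvoidable G
avoidVertex G em nullFnd u with em {∃ λ S → Removable G S × S u ≡ true}
... | no notRemovable =
  ⊥-elim (nullFnd (u , λ S rem → ¬-not (λ Su → notRemovable (S , rem , Su))))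
... | yes (S , (_ , _ , iso) , Su) with embeddingOutside G S iso
...   | ψ , outside = ψ , λ { (x , refl) → trueNotFalse (≡-trans (≡-sym Su) (outside x)) }
  where
    trueNotFalse : ¬ (true ≡ false)
    trueNotFalse ()

avoidList : {G : Graph} → ExcludedMiddle 0ℓ → EveryVertexAvoidable G →
  (Θ : SelfEmbedding G) (L : List (V G)) →
  Σ (SelfEmbedding G) λ Φ → All (λ u → ¬ Image (Θ ∘ₑ Φ) u) L
avoidList em avoid Θ [] = idEmb , []
avoidList em avoid Θ (v ∷ L) with avoidList em avoid Θ L
... | Φ , missesL with em {Image (Θ ∘ₑ Φ) v}
...   | no missesV = Φ , missesV ∷ missesL
...   | yes (x , hit) = Φ ∘ₑ ψ , missesV ∷ All.map (λ miss im → miss (image-∘ (Θ ∘ₑ Φ) ψ im)) missesL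
  where
    ψ = proj₁ (avoid x)
    -- Θ(Φ(ψ y)) = v = Θ(Φ x) would force ψ y = x.
    missesV : ¬ Image (Θ ∘ₑ (Φ ∘ₑ ψ)) v
    missesV (y , p) = proj₂ (avoid x) (y , injective (Θ ∘ₑ Φ) (≡-trans p (≡-sym hit)))

firstEdge : {G : Graph} {x y : V G} → x ≢ y → Walk G x y → ∃ λ z → E G x z × Walk G z y
firstEdge x≢y here = ⊥-elim (x≢y refl)
firstEdge _ (step e q) = _ , e , q

module PhasedWalk (G : Graph) (em : ExcludedMiddle 0ℓ) (connected : Connected G)
  (avoid : EveryVertexAvoidable G) (a : V G) where

  -- Within a phase we walk the outer-image of the remaining walk from the
  -- current position to next(a); history lists the earlier visited vertices.
  record State : Set where
    constructor state
    field
      outer     : SelfEmbedding G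
      next      : SelfEmbedding G
      position  : V G
      remaining : Walk G position (map next a)
      history   : List (V G)
  open State

  current : State → V G
  current s = map (outer s) (position s)

  visited : State → List (V G)
  visited s = current s ∷ history s

  newPhase : SelfEmbedding G → List (V G) → State
  newPhase Θ L = state Θ Φ (proj₁ out) (proj₂ (proj₂ out)) (map Θ a ∷ L)
    where
      Φ = proj₁ (avoidList em avoid Θ (map Θ a ∷ L))
      moves : a ≢ map Φ a
      moves eq = All.head (proj₂ (avoidList em avoid Θ (map Θ a ∷ L)))
                          (a , cong (map Θ) (≡-sym eq))
      out = firstEdge moves (connected a (map Φ a))

  newPhase-adjacent : ∀ Θ L → E G (map Θ a) (current (newPhase Θ L))
  newPhase-adjacent Θ L = preserves Θ (proj₁ (proj₂ (firstEdge _ (connected a _))))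

  advance : State → State
  advance (state Ψ Φ x (step e q) h) = state Ψ Φ _ q (map Ψ x ∷ h)
  advance (state Ψ Φ .(map Φ a) here h) = newPhase (Ψ ∘ₑ Φ) h

  advance-adjacent : ∀ s → E G (current s) (current (advance s))
  advance-adjacent (state Ψ Φ x (step e q) h) = preserves Ψ e
  advance-adjacent (state Ψ Φ .(map Φ a) here h) = newPhase-adjacent (Ψ ∘ₑ Φ) h

  advance-image : ∀ s {u} → Image (outer (advance s)) u → Image (outer s) u
  advance-image (state Ψ Φ x (step e q) h) im = im
  advance-image (state Ψ Φ .(map Φ a) here h) im = image-∘ Ψ Φ im

  run : ℕ → State → State
  run zero s = s
  run (suc n) s = run n (advance s)

  run-+ : ∀ m n s → run (m + n) s ≡ run n (run m s)
  run-+ zero n s = refl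
  run-+ (suc m) n s = run-+ m n (advance s)

  run-advance : ∀ n s → run n (advance s) ≡ advance (run n s)
  run-advance zero s = refl
  run-advance (suc n) s = run-advance n (advance s)

  run-image : ∀ n s {u} → Image (outer (run n s)) u → Image (outer s) u
  run-image zero s im = im
  run-image (suc n) s im = advance-image s (run-image n (advance s) im)

  PhaseEnd : State → Set
  PhaseEnd s = ∃ λ k →
    (∀ {u} → Image (outer (run k s)) u → Image (outer s ∘ₑ next s) u) ×
    All (λ u → ¬ Image (outer (run k s) ∘ₑ next (run k s)) u) (visited s)

  phaseEnd : ∀ {Ψ Φ x} (q : Walk G x (map Φ a)) h → PhaseEnd (state Ψ Φ x q h)
  phaseEnd {Ψ} {Φ} {x} (step e q) h with phaseEnd q (map Ψ x ∷ h)
  ... | k , inside , avoids = suc k , inside , All.tail avoids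
  phaseEnd {Ψ} {Φ} here h =
    1 , (λ im → im) , proj₂ (avoidList em avoid (Ψ ∘ₑ Φ) (map Ψ (map Φ a) ∷ h))

  -- After two phase ends the current vertex is outside the outer image, so
  -- it is never visited again.
  leftForGood : ∀ s → ∃ λ k → ∀ m → current (run m (run k s)) ≢ current s
  leftForGood s with phaseEnd (remaining s) (history s)
  ... | k₁ , _ , avoids₁ with phaseEnd (remaining (run k₁ s)) (history (run k₁ s))
  ...   | k₂ , inside₂ , _ = k₁ + k₂ , never
    where
      never : ∀ m → current (run m (run (k₁ + k₂) s)) ≢ current s
      never m eq rewrite run-+ k₁ k₂ s =
        All.head avoids₁ (inside₂ (run-image m _ (position (run m _) , eq)))

  walk : ℕ → V G
  walk n = current (run n (newPhase idEmb []))

  walk-adjacent : ∀ i → E G (walk i) (walk (suc i))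
  walk-adjacent i = subst (λ s → E G (walk i) (current s))
    (≡-sym (run-advance i (newPhase idEmb [])))
    (advance-adjacent (run i (newPhase idEmb [])))

  walk-transient : ∀ i → ∃ λ N → ∀ j → N ≤ j → walk j ≢ walk i
  walk-transient i with leftForGood (run i (newPhase idEmb []))
  ... | k , never = i + k , λ j N≤j → subst (λ n → walk n ≢ walk i) (m+[n∸m]≡n N≤j)
    (subst (λ s → current s ≢ walk i) (≡-sym (run-after (j ∸ (i + k)))) (never (j ∸ (i + k))))
    where
      run-after : ∀ m → run ((i + k) + m) (newPhase idEmb []) ≡ run m (run k (run i (newPhase idEmb [])))
      run-after m = ≡-trans (run-+ (i + k) m _) (cong (run m) (run-+ i k _))

-- A self-contained graph has a vertex a; the phased walk from a is
-- transient, so it contains a ray.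
theorem2p9 : ExcludedMiddle 0ℓ → (G : Graph) → Connected G → SelfContained G →
    IsNull (Fnd G) → Ray G
theorem2p9 em G connected (_ , (a , _) , _) nullFnd =
  RayFromTransientWalk.ray G em walk walk-adjacent walk-transient
  where
    open PhasedWalk G em connected (avoidVertex G em nullFnd) a
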